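{- Let $s\ge1$ and $k\ge1$ be integers. Then $$\rho_{k,0}(2^s)=\sum_{i=0}^{\lfloor\frac{s-1}{2}\rfloor-1}\Big(2^{ki}2^{(s-2i-3)(k-1)}\cdot\rho^{(1)}_{k,2^{s-2i}}(8)\Big)+2^{\lfloor\frac{s-1}{2}\rfloor k}\cdot\rho^{(1)}_{k,0}\big(2^{s-2\lfloor\frac{s-1}{2}\rfloor}\big)+2^{\lfloor\frac{s}{2}\rfloor k},$$ where the sum is empty (equal to $0$) when its upper limit is $-1$.
   Context: For positive integers $k,n$ and an integer $\mu$, $\rho_{k,\mu}(n)$ is the number of $(x_1,\dots,x_k)\in(\mathbb{Z}/n\mathbb{Z})^k$ with $x_1^2+\cdots+x_k^2\equiv\mu\pmod n$. For integers $t\ge1$ and $\mu$, $\rho^{(1)}_{k,\mu}(2^t)$ is the number of $(x_1,\dots,x_k)\in(\mathbb{Z}/2^t\mathbb{Z})^k$ with $x_1^2+\cdots+x_k^2\equiv\mu\pmod{2^t}$ and $x_i$ odd for at least one $i$. -}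

module Defs where

open import Data.Nat using (ℕ; zero; suc; _+_; _*_; _^_; _%_)
open import Data.Nat.Divisibility using (_∣_; _∣?_)
open import Data.Integer as ℤ using (ℤ; +_; ∣_∣)
open import Data.Fin using (Fin; toℕ)
open import Data.Vec using (Vec; []; _∷_; foldr)
open import Data.List using (List; [_]; concatMap; map; filter; length; allFin)
open import Data.Product using (_×_)
open import Relation.Nullary.Decidable using (_×-dec_)
import Data.Vec.Relation.Unary.Any as VAny
open import Relation.Binary.PropositionalEquality using (_≡_)
import Data.Nat as ℕ

allVecs : (n k : ℕ) → List (Vec (Fin n) k)
allVecs n zero = [ [] ]
allVecs n (suc k) = concatMap (λ x → map (x ∷_) (allVecs n k)) (allFin n)

-- x_1^2 + ... + x_k^2 as an integer (using the representatives 0..n-1)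
sumSq : {n k : ℕ} → Vec (Fin n) k → ℤ
sumSq = foldr _ (λ x acc → (+ (toℕ x * toℕ x)) ℤ.+ acc) (+ 0)

ρ : (k : ℕ) → (μ : ℤ) → (n : ℕ) → ℕ
ρ k μ n = length (filter (λ v → n ∣? ∣ sumSq v ℤ.- μ ∣) (allVecs n k))

ρ⁽¹⁾ : (k : ℕ) → (μ : ℤ) → (t : ℕ) → ℕ
ρ⁽¹⁾ k μ t =
  length (filter (λ v → (2 ^ t ∣? ∣ sumSq v ℤ.- μ ∣) ×-dec VAny.any? (λ x → toℕ x % 2 ℕ.≟ 1) v)
                 (allVecs (2 ^ t) k))

Σ< : ℕ → (ℕ → ℕ) → ℕ
Σ< zero f = 0
Σ< (suc m) f = Σ< m f + f m

-- Split the solutions of x₁² + ⋯ + xₖ² ≡ 0 (mod 2ˢ) into the primitive ones (some xᵢ odd) and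
-- those with every xᵢ even. Writing xᵢ = 2yᵢ, the latter are 2ᵏ times the solutions modulo 2ˢ⁻²,
-- which gives a recursion in steps of two ending at s = 1 or s = 2. For the primitive solutions
-- and t ≥ 3, each solution modulo 2ᵗ lifts to 2ᵏ vectors modulo 2ᵗ⁺¹, solving either μ or μ + 2ᵗ;
-- translating the first odd coordinate by 2ᵗ⁻¹ changes its square by 2ᵗ modulo 2ᵗ⁺¹, so both
-- classes are equally large and ρ⁽¹⁾_{k,μ}(2ᵗ⁺¹) = 2ᵏ⁻¹ ρ⁽¹⁾_{k,μ}(2ᵗ). Hence every primitive
-- count reduces to modulus 8, where μ = 2ˢ⁻²ⁱ acts like μ = 0.

module Submission where

open import Defs

open import Data.Bool using (Bool; true; false; _∧_; _∨_; not; if_then_else_)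
open import Data.Bool.Properties using (∧-zeroʳ; ∧-identityʳ)
open import Data.Fin using (Fin; toℕ)
import Data.Fin as Fin
open import Data.Integer using (+_; ∣_∣; _⊖_)
import Data.Integer as ℤ
import Data.Integer.Properties as ℤP
open import Data.List using (List; []; _∷_; [_]; _++_; filter; length; map; tabulate; concatMap; allFin)
import Data.List.Properties as LP
open import Data.Nat
  using (ℕ; zero; suc; _+_; _*_; _∸_; _^_; _≤_; _<_; z≤n; s≤s; NonZero; _%_; _/_; _≟_; _<?_; >-nonZero⁻¹)
open import Data.Nat.DivMod
open import Data.Nat.Divisibility using (_∣_; divides; _∣?_)
open import Data.Nat.ListAction using (sum)
open import Data.Nat.Properties
open import Data.Nat.Tactic.RingSolver using (solve-∀)
open import Data.Product using (_×_; _,_)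
open import Data.Sum using (_⊎_; inj₁; inj₂)
open import Data.Vec using (Vec; []; _∷_)
import Data.Vec.Relation.Unary.Any as VAny
open import Function using (_∘_; id)
open import Function.Bundles using (_⇔_; mk⇔)
import Function.Properties.Equivalence as ⇔
open import Relation.Binary.PropositionalEquality hiding ([_])
open import Relation.Nullary using (does; proof; yes; no)
open import Relation.Nullary.Decidable using (dec-true; dec-false; does-⇔)
open import Relation.Nullary.Reflects using (Reflects; invert)
open import Relation.Unary using (Pred; Decidable)

open ≡-Reasoning

-- Finite sums

Σ<-cong : ∀ n {f g : ℕ → ℕ} → (∀ i → i < n → f i ≡ g i) → Σ< n f ≡ Σ< n g
Σ<-cong zero    f≡g = refl
Σ<-cong (suc n) f≡g = cong₂ _+_ (Σ<-cong n (λ i i<n → f≡g i (m<n⇒m<1+n i<n))) (f≡g n ≤-refl)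

Σ<-cong′ : ∀ n {f g : ℕ → ℕ} → (∀ i → f i ≡ g i) → Σ< n f ≡ Σ< n g
Σ<-cong′ n f≡g = Σ<-cong n (λ i _ → f≡g i)

Σ<-distrib-+ : ∀ n (f g : ℕ → ℕ) → Σ< n (λ i → f i + g i) ≡ Σ< n f + Σ< n g
Σ<-distrib-+ zero    f g = refl
Σ<-distrib-+ (suc n) f g = begin
  Σ< n (λ i → f i + g i) + (f n + g n) ≡⟨ cong (_+ (f n + g n)) (Σ<-distrib-+ n f g) ⟩
  Σ< n f + Σ< n g + (f n + g n)        ≡⟨ swap (Σ< n f) (Σ< n g) (f n) (g n) ⟩
  Σ< n f + f n + (Σ< n g + g n)        ∎
  where
  swap : ∀ a b c d → a + b + (c + d) ≡ a + c + (b + d)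
  swap = solve-∀

Σ<-distribˡ-* : ∀ n c (f : ℕ → ℕ) → Σ< n (λ i → c * f i) ≡ c * Σ< n f
Σ<-distribˡ-* zero    c f = sym (*-zeroʳ c)
Σ<-distribˡ-* (suc n) c f = trans (cong (_+ c * f n) (Σ<-distribˡ-* n c f)) (sym (*-distribˡ-+ c (Σ< n f) (f n)))

Σ<-zero : ∀ n → Σ< n (λ _ → 0) ≡ 0
Σ<-zero zero    = refl
Σ<-zero (suc n) = trans (+-identityʳ _) (Σ<-zero n)

Σ<-const : ∀ n c → Σ< n (λ _ → c) ≡ n * c
Σ<-const zero    c = refl
Σ<-const (suc n) c = trans (cong (_+ c) (Σ<-const n c)) (+-comm (n * c) c)

Σ<-+ : ∀ a b (f : ℕ → ℕ) → Σ< (a + b) f ≡ Σ< a f + Σ< b (λ i → f (a + i))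
Σ<-+ a zero    f = trans (cong (λ n → Σ< n f) (+-identityʳ a)) (sym (+-identityʳ _))
Σ<-+ a (suc b) f = begin
  Σ< (a + suc b) f                                  ≡⟨ cong (λ n → Σ< n f) (+-suc a b) ⟩
  Σ< (a + b) f + f (a + b)                          ≡⟨ cong (_+ f (a + b)) (Σ<-+ a b f) ⟩
  Σ< a f + Σ< b (λ i → f (a + i)) + f (a + b)       ≡⟨ +-assoc (Σ< a f) _ _ ⟩
  Σ< a f + (Σ< b (λ i → f (a + i)) + f (a + b))     ∎

Σ<-suc : ∀ n (f : ℕ → ℕ) → Σ< (suc n) f ≡ f 0 + Σ< n (λ i → f (suc i))
Σ<-suc n f = Σ<-+ 1 n f

Σ<-even-odd : ∀ m (f : ℕ → ℕ) → Σ< (2 * m) f ≡ Σ< m (λ y → f (2 * y)) + Σ< m (λ y → f (1 + 2 * y))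
Σ<-even-odd zero    f = refl
Σ<-even-odd (suc m) f = begin
  Σ< (2 * suc m) f                              ≡⟨ cong (λ n → Σ< n f) (*-suc 2 m) ⟩
  Σ< (2 * m) f + f (2 * m) + f (1 + 2 * m)      ≡⟨ cong (λ s → s + f (2 * m) + f (1 + 2 * m)) (Σ<-even-odd m f) ⟩
  E + O + f (2 * m) + f (1 + 2 * m)             ≡⟨ swap E O (f (2 * m)) (f (1 + 2 * m)) ⟩
  E + f (2 * m) + (O + f (1 + 2 * m))           ∎
  where
  E = Σ< m (λ y → f (2 * y))
  O = Σ< m (λ y → f (1 + 2 * y))
  swap : ∀ a b c d → a + b + c + d ≡ a + c + (b + d)
  swap = solve-∀

Σ<-if : ∀ n (b : ℕ → Bool) (u v : ℕ → ℕ) →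
  Σ< n (λ x → if b x then u x else v x) ≡ Σ< n (λ x → if b x then u x else 0) + Σ< n (λ x → if b x then 0 else v x)
Σ<-if n b u v = trans (Σ<-cong′ n split) (Σ<-distrib-+ n _ _)
  where
  split : ∀ x → (if b x then u x else v x) ≡ (if b x then u x else 0) + (if b x then 0 else v x)
  split x with b x
  ... | true  = sym (+-identityʳ _)
  ... | false = refl

Σ<-rotate : ∀ n h (g : ℕ → ℕ) .{{_ : NonZero n}} → h ≤ n → Σ< n g ≡ Σ< n (λ x → g ((x + h) % n))
Σ<-rotate n h g h≤n = begin
  Σ< n g                                     ≡⟨ cong (λ m → Σ< m g) (sym h+r≡n) ⟩
  Σ< (h + r) g                               ≡⟨ Σ<-+ h r g ⟩
  Σ< h g + Σ< r (λ i → g (h + i))            ≡⟨ +-comm (Σ< h g) _ ⟩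
  Σ< r (λ i → g (h + i)) + Σ< h g            ≡⟨ cong₂ _+_ (Σ<-cong r tail) (Σ<-cong h head) ⟩
  Σ< r G + Σ< h (λ i → G (r + i))            ≡⟨ Σ<-+ r h G ⟨
  Σ< (r + h) G                               ≡⟨ cong (λ m → Σ< m G) (trans (+-comm r h) h+r≡n) ⟩
  Σ< n G                                     ∎
  where
  r = n ∸ h
  h+r≡n : h + r ≡ n
  h+r≡n = m+[n∸m]≡n h≤n
  G : ℕ → ℕ
  G x = g ((x + h) % n)
  tail : ∀ i → i < r → g (h + i) ≡ G i
  tail i i<r = cong g (sym (begin
    (i + h) % n ≡⟨ cong (_% n) (+-comm i h) ⟩
    (h + i) % n ≡⟨ m<n⇒m%n≡m (subst (h + i <_) h+r≡n (+-monoʳ-< h i<r)) ⟩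
    h + i       ∎))
  head : ∀ i → i < h → g i ≡ G (r + i)
  head i i<h = cong g (sym (begin
    (r + i + h) % n ≡⟨ cong (_% n) (trans (rearrange r i h) (cong (_+_ i) h+r≡n)) ⟩
    (i + n) % n     ≡⟨ [m+n]%n≡m%n i n ⟩
    i % n           ≡⟨ m<n⇒m%n≡m (≤-trans i<h h≤n) ⟩
    i               ∎))
    where
    rearrange : ∀ r i h → r + i + h ≡ i + (h + r)
    rearrange = solve-∀

𝟙 : Bool → ℕ
𝟙 true  = 1
𝟙 false = 0

isOdd : ℕ → Bool
isOdd x = does (x % 2 ≟ 1)

isOdd⇒%2≡1 : ∀ x → isOdd x ≡ true → x % 2 ≡ 1
isOdd⇒%2≡1 x odd = invert (subst (Reflects (x % 2 ≡ 1)) odd (proof (x % 2 ≟ 1)))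

isOdd-+-even : ∀ {m} y → 2 ∣ m → isOdd (m + y) ≡ isOdd y
isOdd-+-even y 2∣m = cong (λ r → does (r ≟ 1)) (%-remove-+ˡ y 2∣m)

isOdd-2* : ∀ y → isOdd (2 * y) ≡ false
isOdd-2* y = cong (λ r → does (r ≟ 1)) (trans (cong (_% 2) (*-comm 2 y)) (m*n%n≡0 y 2))

isOdd-1+2* : ∀ y → isOdd (1 + 2 * y) ≡ true
isOdd-1+2* y = cong (λ r → does (r ≟ 1)) (trans (cong (λ z → (1 + z) % 2) (*-comm 2 y)) ([m+kn]%n≡m%n 1 y 2))

eqMod : (m : ℕ) .{{_ : NonZero m}} → ℕ → ℕ → Bool
eqMod m a b = does (a % m ≟ b % m)

0%n≡0 : ∀ n .{{_ : NonZero n}} → 0 % n ≡ 0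
0%n≡0 n = m<n⇒m%n≡m (>-nonZero⁻¹ n)

𝟙-∧ : ∀ x y → 𝟙 (x ∧ y) ≡ 𝟙 x * 𝟙 y
𝟙-∧ true  y = sym (+-identityʳ (𝟙 y))
𝟙-∧ false y = refl

2^-nonZero : ∀ t → NonZero (2 ^ t)
2^-nonZero t = m^n≢0 2 t

2∣2^[1+t] : ∀ t → 2 ∣ 2 ^ (1 + t)
2∣2^[1+t] t = divides (2 ^ t) (*-comm 2 (2 ^ t))

eqMod-congˡ : ∀ m .{{_ : NonZero m}} {a b} μ → a % m ≡ b % m → eqMod m a μ ≡ eqMod m b μ
eqMod-congˡ m μ a≡b = cong (λ r → does (r ≟ μ % m)) a≡b

%-+ˡ-cong : ∀ c {a b} m .{{_ : NonZero m}} → a % m ≡ b % m → (c + a) % m ≡ (c + b) % m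
%-+ˡ-cong c {a} {b} m a≡b = begin
  (c + a) % m             ≡⟨ %-distribˡ-+ c a m ⟩
  (c % m + a % m) % m     ≡⟨ cong (λ r → (c % m + r) % m) a≡b ⟩
  (c % m + b % m) % m     ≡⟨ %-distribˡ-+ c b m ⟨
  (c + b) % m             ∎

%-+ʳ-cong : ∀ c {a b} m .{{_ : NonZero m}} → a % m ≡ b % m → (a + c) % m ≡ (b + c) % m
%-+ʳ-cong c {a} {b} m a≡b = begin
  (a + c) % m ≡⟨ cong (_% m) (+-comm a c) ⟩
  (c + a) % m ≡⟨ %-+ˡ-cong c m a≡b ⟩
  (c + b) % m ≡⟨ cong (_% m) (+-comm c b) ⟩
  (b + c) % m ∎

[m+i]²+a%m≡i²+a%m : ∀ m i a .{{_ : NonZero m}} → ((m + i) * (m + i) + a) % m ≡ (i * i + a) % m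
[m+i]²+a%m≡i²+a%m m i a = trans (cong (_% m) (expand m i a)) ([m+kn]%n≡m%n (i * i + a) (m + 2 * i) m)
  where
  expand : ∀ m i a → (m + i) * (m + i) + a ≡ i * i + a + (m + 2 * i) * m
  expand = solve-∀

-- Σsq n k f sums f (x₁² + ⋯ + xₖ²) (some xᵢ is odd) over all x ∈ {0, …, n-1}ᵏ.
Σsq : ℕ → ℕ → (ℕ → Bool → ℕ) → ℕ
Σsq n zero    f = f 0 false
Σsq n (suc k) f = Σ< n (λ x → Σsq n k (λ a o → f (x * x + a) (isOdd x ∨ o)))

Σsq-cong : ∀ n k {f g : ℕ → Bool → ℕ} → (∀ a o → f a o ≡ g a o) → Σsq n k f ≡ Σsq n k g
Σsq-cong n zero    f≡g = f≡g 0 false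
Σsq-cong n (suc k) f≡g = Σ<-cong′ n (λ x → Σsq-cong n k (λ a o → f≡g (x * x + a) (isOdd x ∨ o)))

Σsq-distrib-+ : ∀ n k (f g : ℕ → Bool → ℕ) → Σsq n k (λ a o → f a o + g a o) ≡ Σsq n k f + Σsq n k g
Σsq-distrib-+ n zero    f g = refl
Σsq-distrib-+ n (suc k) f g = trans (Σ<-cong′ n (λ x → Σsq-distrib-+ n k _ _)) (Σ<-distrib-+ n _ _)

Σsq-zero : ∀ n k → Σsq n k (λ _ _ → 0) ≡ 0
Σsq-zero n zero    = refl
Σsq-zero n (suc k) = trans (Σ<-cong′ n (λ _ → Σsq-zero n k)) (Σ<-zero n)

Σsq-const : ∀ n k c → Σsq n k (λ _ _ → c) ≡ n ^ k * c
Σsq-const n zero    c = sym (+-identityʳ c)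
Σsq-const n (suc k) c = begin
  Σ< n (λ _ → Σsq n k (λ _ _ → c)) ≡⟨ Σ<-cong′ n (λ _ → Σsq-const n k c) ⟩
  Σ< n (λ _ → n ^ k * c)           ≡⟨ Σ<-const n _ ⟩
  n * (n ^ k * c)                  ≡⟨ *-assoc n (n ^ k) c ⟨
  n ^ suc k * c                    ∎

-- When 2 ∣ m, both x² mod m and the parity of x depend only on x mod m.
Σsq-double : ∀ m .{{_ : NonZero m}} → 2 ∣ m → ∀ k (f : ℕ → Bool → ℕ) →
  (∀ a b o → a % m ≡ b % m → f a o ≡ f b o) → Σsq (2 * m) k f ≡ 2 ^ k * Σsq m k f
Σsq-double m 2∣m zero    f f-periodic = sym (+-identityʳ _)
Σsq-double m 2∣m (suc k) f f-periodic = begin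
  Σ< (2 * m) (λ x → Σsq (2 * m) k (f′ x))     ≡⟨ Σ<-cong′ (2 * m) (λ x → Σsq-double m 2∣m k (f′ x) (f′-periodic x)) ⟩
  Σ< (m + (m + 0)) U                          ≡⟨ cong (λ n → Σ< (m + n) U) (+-identityʳ m) ⟩
  Σ< (m + m) U                                ≡⟨ Σ<-+ m m U ⟩
  Σ< m U + Σ< m (λ i → U (m + i))             ≡⟨ cong (_+_ (Σ< m U)) (Σ<-cong′ m U-periodic) ⟩
  Σ< m U + Σ< m U                             ≡⟨ cong (_+_ (Σ< m U)) (+-identityʳ _) ⟨
  2 * Σ< m U                                  ≡⟨ cong (2 *_) (Σ<-distribˡ-* m (2 ^ k) _) ⟩
  2 * (2 ^ k * Σsq m (suc k) f)               ≡⟨ *-assoc 2 (2 ^ k) _ ⟨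
  2 ^ suc k * Σsq m (suc k) f                 ∎
  where
  f′ : ℕ → ℕ → Bool → ℕ
  f′ x a o = f (x * x + a) (isOdd x ∨ o)
  f′-periodic : ∀ x a b o → a % m ≡ b % m → f′ x a o ≡ f′ x b o
  f′-periodic x a b o a≡b = f-periodic _ _ _ (%-+ˡ-cong (x * x) m a≡b)
  U : ℕ → ℕ
  U x = 2 ^ k * Σsq m k (f′ x)
  U-periodic : ∀ i → U (m + i) ≡ U i
  U-periodic i = cong (2 ^ k *_) (Σsq-cong m k (λ a o →
    trans (cong (f ((m + i) * (m + i) + a)) (cong (_∨ o) (isOdd-+-even i 2∣m)))
          (f-periodic _ _ _ ([m+i]²+a%m≡i²+a%m m i a))))

Σsq-allEven : ∀ m k (g : ℕ → Bool) →
  Σsq (2 * m) k (λ a o → 𝟙 (g a ∧ not o)) ≡ Σsq m k (λ a _ → 𝟙 (g (4 * a)))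
Σsq-allEven m zero    g = cong 𝟙 (∧-identityʳ (g 0))
Σsq-allEven m (suc k) g = begin
  Σ< (2 * m) T                                               ≡⟨ Σ<-even-odd m T ⟩
  Σ< m (λ y → T (2 * y)) + Σ< m (λ y → T (1 + 2 * y))        ≡⟨ cong₂ _+_ (Σ<-cong′ m even) (trans (Σ<-cong′ m odd) (Σ<-zero m)) ⟩
  Σ< m (λ y → Σsq m k (λ a _ → 𝟙 (g (4 * (y * y + a))))) + 0 ≡⟨ +-identityʳ _ ⟩
  Σsq m (suc k) (λ a _ → 𝟙 (g (4 * a)))                      ∎
  where
  T : ℕ → ℕ
  T x = Σsq (2 * m) k (λ a o → 𝟙 (g (x * x + a) ∧ not (isOdd x ∨ o)))
  [2y]²+4a : ∀ y a → 2 * y * (2 * y) + 4 * a ≡ 4 * (y * y + a)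
  [2y]²+4a = solve-∀
  even : ∀ y → Σsq (2 * m) k (λ a o → 𝟙 (g (2 * y * (2 * y) + a) ∧ not (isOdd (2 * y) ∨ o)))
             ≡ Σsq m k (λ a _ → 𝟙 (g (4 * (y * y + a))))
  even y rewrite isOdd-2* y = trans (Σsq-allEven m k (λ a → g (2 * y * (2 * y) + a)))
                                    (Σsq-cong m k (λ a _ → cong (𝟙 ∘ g) ([2y]²+4a y a)))
  odd : ∀ y → Σsq (2 * m) k (λ a o → 𝟙 (g ((1 + 2 * y) * (1 + 2 * y) + a) ∧ not (isOdd (1 + 2 * y) ∨ o))) ≡ 0
  odd y rewrite isOdd-1+2* y = trans (Σsq-cong (2 * m) k (λ a _ → cong 𝟙 (∧-zeroʳ _))) (Σsq-zero (2 * m) k)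

module _ (M : ℕ) .{{_ : NonZero M}} .{{_ : NonZero (2 * M)}} where

  private
    M<2M : M < 2 * M
    M<2M = m<m+n M (subst (0 <_) (sym (+-identityʳ M)) (>-nonZero⁻¹ M))

    r+M<2M : ∀ {r} → r < M → r + M < 2 * M
    r+M<2M {r} r<M = subst (r + M <_) (cong (_+_ M) (sym (+-identityʳ M))) (+-monoˡ-< M r<M)

    [μ+M]%2M : ∀ μ → (μ + M) % (2 * M) ≡ (μ % (2 * M) + M) % (2 * M)
    [μ+M]%2M μ = trans (%-distribˡ-+ μ M (2 * M)) (cong (λ r → (μ % (2 * M) + r) % (2 * M)) (m<n⇒m%n≡m M<2M))

  %-2* : ∀ a → a % (2 * M) ≡ a % M ⊎ a % (2 * M) ≡ a % M + M
  %-2* a with a % (2 * M) <? M | m∣n⇒o%n%m≡o%m M (2 * M) a (divides 2 refl)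
  ... | yes r<M | r%M≡a%M = inj₁ (trans (sym (m<n⇒m%n≡m r<M)) r%M≡a%M)
  ... | no  r≮M | r%M≡a%M = inj₂ (sym (begin
    a % M + M          ≡⟨ cong (_+ M) (sym r%M≡a%M) ⟩
    r % M + M          ≡⟨ cong (_+ M) (sym (m≤n⇒[n∸m]%m≡n%m M≤r)) ⟩
    (r ∸ M) % M + M    ≡⟨ cong (_+ M) (m<n⇒m%n≡m r∸M<M) ⟩
    r ∸ M + M          ≡⟨ m∸n+n≡m M≤r ⟩
    r                  ∎))
    where
    r = a % (2 * M)
    M≤r : M ≤ r
    M≤r = ≮⇒≥ r≮M
    r∸M<M : r ∸ M < M
    r∸M<M = m<n+o⇒m∸n<o r M (subst (r <_) (cong (_+_ M) (+-identityʳ M)) (m%n<n a (2 * M)))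

  %-2*-+ : ∀ μ → (μ % (2 * M) ≡ μ % M × (μ + M) % (2 * M) ≡ μ % M + M)
               ⊎ (μ % (2 * M) ≡ μ % M + M × (μ + M) % (2 * M) ≡ μ % M)
  %-2*-+ μ with %-2* μ
  ... | inj₁ low  = inj₁ (low , (begin
    (μ + M) % (2 * M)            ≡⟨ [μ+M]%2M μ ⟩
    (μ % (2 * M) + M) % (2 * M)  ≡⟨ cong (λ r → (r + M) % (2 * M)) low ⟩
    (μ % M + M) % (2 * M)        ≡⟨ m<n⇒m%n≡m (r+M<2M (m%n<n μ M)) ⟩
    μ % M + M                    ∎))
  ... | inj₂ high = inj₂ (high , (begin
    (μ + M) % (2 * M)            ≡⟨ [μ+M]%2M μ ⟩
    (μ % (2 * M) + M) % (2 * M)  ≡⟨ cong (λ r → (r + M) % (2 * M)) high ⟩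
    (μ % M + M + M) % (2 * M)    ≡⟨ cong (_% (2 * M)) (+-assoc (μ % M) M M) ⟩
    (μ % M + (M + M)) % (2 * M)  ≡⟨ cong (λ z → (μ % M + (M + z)) % (2 * M)) (+-identityʳ M) ⟨
    (μ % M + 2 * M) % (2 * M)    ≡⟨ [m+n]%n≡m%n (μ % M) (2 * M) ⟩
    μ % M % (2 * M)              ≡⟨ m<n⇒m%n≡m (<-trans (m%n<n μ M) M<2M) ⟩
    μ % M                        ∎))

  private
    r≢u+M : ∀ {r} u → r < M → does (r ≟ u + M) ≡ false
    r≢u+M {r} u r<M = dec-false (r ≟ u + M) (λ r≡u+M → <-irrefl r≡u+M (≤-trans r<M (m≤n+m M u)))

    r+M≢u : ∀ r {u} → u < M → does (r + M ≟ u) ≡ false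
    r+M≢u r {u} u<M = dec-false (r + M ≟ u) (λ r+M≡u → <-irrefl (sym r+M≡u) (≤-trans u<M (m≤n+m M r)))

    r+M≟u+M : ∀ r u → does (r + M ≟ u + M) ≡ does (r ≟ u)
    r+M≟u+M r u = does-⇔ (mk⇔ (+-cancelʳ-≡ M r u) (cong (_+ M))) (r + M ≟ u + M) (r ≟ u)

    -- r, u, A, B, C are the residues of a mod M, μ mod M, a mod 2M, μ mod 2M and (μ + M) mod 2M.
    residue-split : ∀ {r u A B C} → r < M → u < M → A ≡ r ⊎ A ≡ r + M →
      (B ≡ u × C ≡ u + M) ⊎ (B ≡ u + M × C ≡ u) →
      𝟙 (does (r ≟ u)) ≡ 𝟙 (does (A ≟ B)) + 𝟙 (does (A ≟ C))
    residue-split {r} {u} r<M u<M (inj₁ refl) (inj₁ (refl , refl)) =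
      sym (trans (cong (λ b → 𝟙 (does (r ≟ u)) + 𝟙 b) (r≢u+M u r<M)) (+-identityʳ _))
    residue-split {r} {u} r<M u<M (inj₁ refl) (inj₂ (refl , refl)) =
      sym (cong (λ b → 𝟙 b + 𝟙 (does (r ≟ u))) (r≢u+M u r<M))
    residue-split {r} {u} r<M u<M (inj₂ refl) (inj₁ (refl , refl)) =
      sym (cong₂ (λ b c → 𝟙 b + 𝟙 c) (r+M≢u r u<M) (r+M≟u+M r u))
    residue-split {r} {u} r<M u<M (inj₂ refl) (inj₂ (refl , refl)) =
      sym (trans (cong₂ (λ b c → 𝟙 b + 𝟙 c) (r+M≟u+M r u) (r+M≢u r u<M)) (+-identityʳ _))

  eqMod-split : ∀ a μ → 𝟙 (eqMod M a μ) ≡ 𝟙 (eqMod (2 * M) a μ) + 𝟙 (eqMod (2 * M) a (μ + M))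
  eqMod-split a μ = residue-split (m%n<n a M) (m%n<n μ M) (%-2* a) (%-2*-+ μ)

-- Translating an odd coordinate

module HalfShift (u : ℕ) where

  h m n : ℕ
  h = 2 ^ (2 + u)
  m = 2 ^ (3 + u)
  n = 2 ^ (4 + u)

  instance
    n≢0 : NonZero n
    n≢0 = 2^-nonZero (4 + u)

  private
    w+m≡μ⇔w≡μ+m : ∀ w μ → eqMod n (w + m) μ ≡ eqMod n w (μ + m)
    w+m≡μ⇔w≡μ+m w μ = does-⇔ (mk⇔ (λ e → trans (sym (z+m+m w)) (%-+ʳ-cong m n e))
                                    (λ e → trans (%-+ʳ-cong m n e) (z+m+m μ)))
                               ((w + m) % n ≟ μ % n) (w % n ≟ (μ + m) % n)
      where
      z+m+m : ∀ z → (z + m + m) % n ≡ z % n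
      z+m+m z = begin
        (z + m + m) % n       ≡⟨ cong (_% n) (+-assoc z m m) ⟩
        (z + (m + m)) % n     ≡⟨ cong (λ w → (z + (m + w)) % n) (+-identityʳ m) ⟨
        (z + n) % n           ≡⟨ [m+n]%n≡m%n z n ⟩
        z % n                 ∎

    isOdd-rotate : ∀ x → isOdd ((x + h) % n) ≡ isOdd x
    isOdd-rotate x = cong (λ r → does (r ≟ 1))
      (trans (m∣n⇒o%n%m≡o%m 2 n (x + h) (2∣2^[1+t] (3 + u))) (%-remove-+ʳ x (2∣2^[1+t] (1 + u))))

  -- (x + h)² = x² + 2hx + h² with 2hx ≡ m for odd x and n ∣ h²; the latter needs the modulus n to be at least 2⁴.
  odd²-shift : ∀ x → x % 2 ≡ 1 → ((x + h) * (x + h)) % n ≡ (x * x + m) % n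
  odd²-shift x x-odd = begin
    ((x + h) * (x + h)) % n                             ≡⟨ cong (λ z → ((z + h) * (z + h)) % n) x≡1+2j ⟩
    ((1 + j * 2 + h) * (1 + j * 2 + h)) % n             ≡⟨ cong (_% n) (expand j (2 ^ u)) ⟩
    ((1 + j * 2) * (1 + j * 2) + m + (j + 2 ^ u) * n) % n ≡⟨ [m+kn]%n≡m%n _ (j + 2 ^ u) n ⟩
    ((1 + j * 2) * (1 + j * 2) + m) % n                 ≡⟨ cong (λ z → (z * z + m) % n) x≡1+2j ⟨
    (x * x + m) % n                                     ∎
    where
    j = x / 2
    x≡1+2j : x ≡ 1 + j * 2
    x≡1+2j = trans (m≡m%n+[m/n]*n x 2) (cong (_+ j * 2) x-odd)
    expand : ∀ j p → (1 + j * 2 + 2 * (2 * p)) * (1 + j * 2 + 2 * (2 * p))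
                   ≡ (1 + j * 2) * (1 + j * 2) + 2 * (2 * (2 * p)) + (j + p) * (2 * (2 * (2 * (2 * p))))
    expand = solve-∀

  private
    %-middle-cong : ∀ c a {z₁ z₂} → z₁ % n ≡ z₂ % n → (c + z₁ + a) % n ≡ (c + z₂ + a) % n
    %-middle-cong c a {z₁} {z₂} z₁≡z₂ = begin
      (c + z₁ + a) % n ≡⟨ cong (_% n) (+-right-comm c z₁ a) ⟩
      (c + a + z₁) % n ≡⟨ %-+ˡ-cong (c + a) n z₁≡z₂ ⟩
      (c + a + z₂) % n ≡⟨ cong (_% n) (+-right-comm c a z₂) ⟩
      (c + z₂ + a) % n ∎
      where
      +-right-comm : ∀ x y z → x + y + z ≡ x + z + y
      +-right-comm = solve-∀

    rotated-square : ∀ x c a → x % 2 ≡ 1 →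
      (c + (x + h) % n * ((x + h) % n) + a) % n ≡ (c + x * x + a + m) % n
    rotated-square x c a x-odd = begin
      (c + (x + h) % n * ((x + h) % n) + a) % n ≡⟨ %-middle-cong c a (sym (%-distribˡ-* (x + h) (x + h) n)) ⟩
      (c + (x + h) * (x + h) + a) % n           ≡⟨ %-middle-cong c a (odd²-shift x x-odd) ⟩
      (c + (x * x + m) + a) % n                 ≡⟨ cong (_% n) (rearrange c (x * x) m a) ⟩
      (c + x * x + a + m) % n                   ∎
      where
      rearrange : ∀ c s m a → c + (s + m) + a ≡ c + s + a + m
      rearrange = solve-∀

    h≤n : h ≤ n
    h≤n = ≤-trans (m≤m+n h (h + 0)) (m≤m+n m (m + 0))

  -- Translating the first odd coordinate by h shifts the sum of squares by m modulo n.
  primitive-shift : ∀ k c μ → Σsq n k (λ a o → 𝟙 (eqMod n (c + a) μ ∧ o))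
                            ≡ Σsq n k (λ a o → 𝟙 (eqMod n (c + a) (μ + m) ∧ o))
  primitive-shift zero    c μ = trans (cong 𝟙 (∧-zeroʳ _)) (cong 𝟙 (sym (∧-zeroʳ _)))
  primitive-shift (suc k) c μ = begin
    Σ< n (T μ)                                                ≡⟨ Σ<-cong′ n (T-split μ) ⟩
    Σ< n (λ x → if isOdd x then U μ x else V μ x)             ≡⟨ Σ<-if n isOdd (U μ) (V μ) ⟩
    Σ< n (λ x → if isOdd x then U μ x else 0)
      + Σ< n (λ x → if isOdd x then 0 else V μ x)             ≡⟨ cong₂ _+_ (trans (Σ<-rotate n h _ h≤n) (Σ<-cong′ n rotate-odd))
                                                                            (Σ<-cong′ n shift-even) ⟩
    Σ< n (λ x → if isOdd x then U (μ + m) x else 0)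
      + Σ< n (λ x → if isOdd x then 0 else V (μ + m) x)       ≡⟨ Σ<-if n isOdd (U (μ + m)) (V (μ + m)) ⟨
    Σ< n (λ x → if isOdd x then U (μ + m) x else V (μ + m) x) ≡⟨ Σ<-cong′ n (T-split (μ + m)) ⟨
    Σ< n (T (μ + m))                                          ∎
    where
    T U V : ℕ → ℕ → ℕ
    T μ x = Σsq n k (λ a o → 𝟙 (eqMod n (c + (x * x + a)) μ ∧ (isOdd x ∨ o)))
    U μ x = Σsq n k (λ a _ → 𝟙 (eqMod n (c + x * x + a) μ))
    V μ x = Σsq n k (λ a o → 𝟙 (eqMod n (c + x * x + a) μ ∧ o))

    T-split : ∀ μ x → T μ x ≡ (if isOdd x then U μ x else V μ x)
    T-split μ x with isOdd x
    ... | true  = Σsq-cong n k (λ a o → cong 𝟙 (trans (∧-identityʳ _) (cong (λ z → eqMod n z μ) (sym (+-assoc c (x * x) a)))))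
    ... | false = Σsq-cong n k (λ a o → cong (λ z → 𝟙 (eqMod n z μ ∧ o)) (sym (+-assoc c (x * x) a)))

    shift-even : ∀ x → (if isOdd x then 0 else V μ x) ≡ (if isOdd x then 0 else V (μ + m) x)
    shift-even x with isOdd x
    ... | true  = refl
    ... | false = primitive-shift k (c + x * x) μ

    rotate-odd : ∀ x → (if isOdd ((x + h) % n) then U μ ((x + h) % n) else 0) ≡ (if isOdd x then U (μ + m) x else 0)
    rotate-odd x with isOdd x in x-odd | isOdd-rotate x
    ... | false | rotated rewrite rotated = refl
    ... | true  | rotated rewrite rotated = Σsq-cong n k (λ a _ → cong 𝟙 (trans
            (cong (λ r → does (r ≟ μ % n)) (rotated-square x c a (isOdd⇒%2≡1 x x-odd)))
            (w+m≡μ⇔w≡μ+m (c + x * x + a) μ)))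

-- Counting solutions modulo powers of two

zeroCount imprimitiveCount : ℕ → ℕ → ℕ
zeroCount t k = Σsq (2 ^ t) k (λ a _ → 𝟙 (eqMod (2 ^ t) {{2^-nonZero t}} a 0))
imprimitiveCount t k = Σsq (2 ^ t) k (λ a o → 𝟙 (eqMod (2 ^ t) {{2^-nonZero t}} a 0 ∧ not o))

primitiveCount : ℕ → ℕ → ℕ → ℕ
primitiveCount t k μ = Σsq (2 ^ t) k (λ a o → 𝟙 (eqMod (2 ^ t) {{2^-nonZero t}} a μ ∧ o))

zeroCount≡primitive+imprimitive : ∀ t k → zeroCount t k ≡ primitiveCount t k 0 + imprimitiveCount t k
zeroCount≡primitive+imprimitive t k = trans (Σsq-cong (2 ^ t) k (λ a o → split _ o)) (Σsq-distrib-+ (2 ^ t) k _ _)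
  where
  split : ∀ x o → 𝟙 x ≡ 𝟙 (x ∧ o) + 𝟙 (x ∧ not o)
  split true  true  = refl
  split true  false = refl
  split false _     = refl

primitiveCount-lift : ∀ t k μ →
  primitiveCount (2 + t) k μ + primitiveCount (2 + t) k (μ + 2 ^ (1 + t)) ≡ 2 ^ k * primitiveCount (1 + t) k μ
primitiveCount-lift t k μ = begin
  primitiveCount (2 + t) k μ + primitiveCount (2 + t) k (μ + M)     ≡⟨ Σsq-distrib-+ (2 * M) k _ _ ⟨
  Σsq (2 * M) k (λ a o → 𝟙 (eqMod (2 * M) a μ ∧ o) + 𝟙 (eqMod (2 * M) a (μ + M) ∧ o))
                                                                    ≡⟨ Σsq-cong (2 * M) k split ⟨
  Σsq (2 * M) k f                                                   ≡⟨ Σsq-double M (2∣2^[1+t] t) k f f-periodic ⟩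
  2 ^ k * primitiveCount (1 + t) k μ                                ∎
  where
  M = 2 ^ (1 + t)
  instance
    M≢0 : NonZero M
    M≢0 = 2^-nonZero (1 + t)
    2M≢0 : NonZero (2 * M)
    2M≢0 = 2^-nonZero (2 + t)
  f : ℕ → Bool → ℕ
  f a o = 𝟙 (eqMod M a μ ∧ o)
  f-periodic : ∀ a b o → a % M ≡ b % M → f a o ≡ f b o
  f-periodic a b o a≡b = cong (λ x → 𝟙 (x ∧ o)) (eqMod-congˡ M μ a≡b)
  split : ∀ a o → f a o ≡ 𝟙 (eqMod (2 * M) a μ ∧ o) + 𝟙 (eqMod (2 * M) a (μ + M) ∧ o)
  split a o = begin
    𝟙 (eqMod M a μ ∧ o)                                         ≡⟨ 𝟙-∧ _ o ⟩
    𝟙 (eqMod M a μ) * 𝟙 o                                       ≡⟨ cong (_* 𝟙 o) (eqMod-split M a μ) ⟩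
    (𝟙 (eqMod (2 * M) a μ) + 𝟙 (eqMod (2 * M) a (μ + M))) * 𝟙 o ≡⟨ *-distribʳ-+ (𝟙 o) (𝟙 (eqMod (2 * M) a μ)) _ ⟩
    𝟙 (eqMod (2 * M) a μ) * 𝟙 o + 𝟙 (eqMod (2 * M) a (μ + M)) * 𝟙 o
                                                                ≡⟨ cong₂ _+_ (𝟙-∧ (eqMod (2 * M) a μ) o) (𝟙-∧ (eqMod (2 * M) a (μ + M)) o) ⟨
    𝟙 (eqMod (2 * M) a μ ∧ o) + 𝟙 (eqMod (2 * M) a (μ + M) ∧ o) ∎

primitiveCount-step : ∀ u k μ → primitiveCount (4 + u) (suc k) μ ≡ 2 ^ k * primitiveCount (3 + u) (suc k) μ
primitiveCount-step u k μ = *-cancelˡ-≡ _ _ 2 (begin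
  2 * P₄                                 ≡⟨ cong (_+_ P₄) (+-identityʳ P₄) ⟩
  P₄ + P₄                                ≡⟨ cong (_+_ P₄) (HalfShift.primitive-shift u (suc k) 0 μ) ⟩
  P₄ + primitiveCount (4 + u) (suc k) (μ + 2 ^ (3 + u))
                                         ≡⟨ primitiveCount-lift (2 + u) (suc k) μ ⟩
  2 ^ suc k * primitiveCount (3 + u) (suc k) μ
                                         ≡⟨ *-assoc 2 (2 ^ k) _ ⟩
  2 * (2 ^ k * primitiveCount (3 + u) (suc k) μ) ∎)
  where
  P₄ = primitiveCount (4 + u) (suc k) μ

primitiveCount-from-3 : ∀ j k μ → primitiveCount (3 + j) (suc k) μ ≡ 2 ^ (j * k) * primitiveCount 3 (suc k) μ
primitiveCount-from-3 zero    k μ = sym (+-identityʳ _)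
primitiveCount-from-3 (suc j) k μ = begin
  primitiveCount (4 + j) (suc k) μ                  ≡⟨ primitiveCount-step j k μ ⟩
  2 ^ k * primitiveCount (3 + j) (suc k) μ          ≡⟨ cong (2 ^ k *_) (primitiveCount-from-3 j k μ) ⟩
  2 ^ k * (2 ^ (j * k) * primitiveCount 3 (suc k) μ) ≡⟨ *-assoc (2 ^ k) _ _ ⟨
  2 ^ k * 2 ^ (j * k) * primitiveCount 3 (suc k) μ   ≡⟨ cong (_* primitiveCount 3 (suc k) μ) (^-distribˡ-+-* 2 k (j * k)) ⟨
  2 ^ (k + j * k) * primitiveCount 3 (suc k) μ       ∎

primitiveCount-3-2^ : ∀ r k → primitiveCount 3 k (2 ^ (3 + r)) ≡ primitiveCount 3 k 0
primitiveCount-3-2^ r k = Σsq-cong 8 k (λ a o → cong (λ z → 𝟙 (does (a % 8 ≟ z) ∧ o)) 2^[3+r]%8≡0)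
  where
  2^[3+r]%8≡0 : 2 ^ (3 + r) % 8 ≡ 0
  2^[3+r]%8≡0 = trans (cong (_% 8) (8*q≡q*8 (2 ^ r))) (m*n%n≡0 (2 ^ r) 8)
    where
    8*q≡q*8 : ∀ q → 2 * (2 * (2 * q)) ≡ q * 8
    8*q≡q*8 = solve-∀

eqMod-4*-0 : ∀ M .{{_ : NonZero M}} .{{_ : NonZero (2 * (2 * M))}} a → eqMod (2 * (2 * M)) (4 * a) 0 ≡ eqMod M a 0
eqMod-4*-0 M a = does-⇔ (mk⇔ to from) (4 * a % (2 * (2 * M)) ≟ 0 % (2 * (2 * M))) (a % M ≟ 0 % M)
  where
  instance
    4M≢0 : NonZero (M * 4)
    4M≢0 = m*n≢0 M 4
  4a%4M≡[a%M]*4 : 4 * a % (2 * (2 * M)) ≡ a % M * 4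
  4a%4M≡[a%M]*4 = begin
    4 * a % (2 * (2 * M)) ≡⟨ cong (_% (2 * (2 * M))) (*-comm 4 a) ⟩
    a * 4 % (2 * (2 * M)) ≡⟨ %-congʳ (4M≡M*4 M) ⟩
    a * 4 % (M * 4)       ≡⟨ m%n*o≡m*o%[n*o] a M 4 ⟨
    a % M * 4             ∎
    where
    4M≡M*4 : ∀ M → 2 * (2 * M) ≡ M * 4
    4M≡M*4 = solve-∀
  to : 4 * a % (2 * (2 * M)) ≡ 0 % (2 * (2 * M)) → a % M ≡ 0 % M
  to e = trans (m*n≡0⇒m≡0 (a % M) 4 (trans (sym 4a%4M≡[a%M]*4) (trans e (0%n≡0 _)))) (sym (0%n≡0 M))
  from : a % M ≡ 0 % M → 4 * a % (2 * (2 * M)) ≡ 0 % (2 * (2 * M))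
  from e = trans 4a%4M≡[a%M]*4 (trans (cong (_* 4) (trans e (0%n≡0 M))) (sym (0%n≡0 _)))

imprimitiveCount-step : ∀ s k → imprimitiveCount (3 + s) k ≡ 2 ^ k * zeroCount (1 + s) k
imprimitiveCount-step s k = begin
  imprimitiveCount (3 + s) k                                        ≡⟨ Σsq-allEven (2 * M) k (λ a → eqMod (2 * (2 * M)) a 0) ⟩
  Σsq (2 * M) k (λ a _ → 𝟙 (eqMod (2 * (2 * M)) (4 * a) 0))         ≡⟨ Σsq-cong (2 * M) k (λ a _ → cong 𝟙 (eqMod-4*-0 M a)) ⟩
  Σsq (2 * M) k (λ a _ → 𝟙 (eqMod M a 0))                           ≡⟨ Σsq-double M (2∣2^[1+t] s) k _ (λ _ _ _ → cong 𝟙 ∘ eqMod-congˡ M 0) ⟩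
  2 ^ k * zeroCount (1 + s) k                                       ∎
  where
  M = 2 ^ (1 + s)
  instance
    M≢0 : NonZero M
    M≢0 = 2^-nonZero (1 + s)
    4M≢0 : NonZero (2 * (2 * M))
    4M≢0 = 2^-nonZero (3 + s)

imprimitiveCount-1 : ∀ k → imprimitiveCount 1 k ≡ 1
imprimitiveCount-1 k = begin
  imprimitiveCount 1 k                       ≡⟨ Σsq-allEven 1 k (λ a → eqMod 2 a 0) ⟩
  Σsq 1 k (λ a _ → 𝟙 (eqMod 2 (4 * a) 0))    ≡⟨ Σsq-cong 1 k (λ a _ → cong 𝟙 (4a≡0 a)) ⟩
  Σsq 1 k (λ _ _ → 1)                        ≡⟨ Σsq-const 1 k 1 ⟩
  1 ^ k * 1                                  ≡⟨ trans (*-identityʳ _) (^-zeroˡ k) ⟩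
  1                                          ∎
  where
  4a≡0 : ∀ a → eqMod 2 (4 * a) 0 ≡ true
  4a≡0 a = dec-true (4 * a % 2 ≟ 0) (trans (cong (_% 2) (4a≡2a*2 a)) (m*n%n≡0 (2 * a) 2))
    where
    4a≡2a*2 : ∀ a → 4 * a ≡ 2 * a * 2
    4a≡2a*2 = solve-∀

imprimitiveCount-2 : ∀ k → imprimitiveCount 2 k ≡ 2 ^ k
imprimitiveCount-2 k = begin
  imprimitiveCount 2 k                       ≡⟨ Σsq-allEven 2 k (λ a → eqMod 4 a 0) ⟩
  Σsq 2 k (λ a _ → 𝟙 (eqMod 4 (4 * a) 0))    ≡⟨ Σsq-cong 2 k (λ a _ → cong 𝟙 (4a≡0 a)) ⟩
  Σsq 2 k (λ _ _ → 1)                        ≡⟨ Σsq-const 2 k 1 ⟩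
  2 ^ k * 1                                  ≡⟨ *-identityʳ _ ⟩
  2 ^ k                                      ∎
  where
  4a≡0 : ∀ a → eqMod 4 (4 * a) 0 ≡ true
  4a≡0 a = dec-true (4 * a % 4 ≟ 0) (trans (cong (_% 4) (*-comm 4 a)) (m*n%n≡0 a 4))

summand : ℕ → ℕ → ℕ → ℕ
summand s k i = 2 ^ (k * i) * 2 ^ ((s ∸ 2 * i ∸ 3) * (k ∸ 1)) * primitiveCount 3 k (2 ^ (s ∸ 2 * i))

-- The right-hand side of the theorem, with ⌊(s - 1)/2⌋ generalised to q for the induction.
closedForm : ℕ → ℕ → ℕ → ℕ
closedForm s k q = Σ< q (summand s k) + 2 ^ (q * k) * primitiveCount (s ∸ 2 * q) k 0 + 2 ^ ((s / 2) * k)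

private
  3+r∸2[1+i] : ∀ r i → 3 + r ∸ 2 * suc i ≡ 1 + r ∸ 2 * i
  3+r∸2[1+i] r i = cong (3 + r ∸_) (*-suc 2 i)

summand-zero : ∀ r k' → summand (3 + r) (suc k') 0 ≡ primitiveCount (3 + r) (suc k') 0
summand-zero r k' = begin
  2 ^ (suc k' * 0) * 2 ^ (r * k') * primitiveCount 3 (suc k') (2 ^ (3 + r))
    ≡⟨ cong (λ e → 2 ^ e * 2 ^ (r * k') * primitiveCount 3 (suc k') (2 ^ (3 + r))) (*-zeroʳ (suc k')) ⟩
  1 * 2 ^ (r * k') * primitiveCount 3 (suc k') (2 ^ (3 + r))
    ≡⟨ cong₂ _*_ (*-identityˡ (2 ^ (r * k'))) (primitiveCount-3-2^ r (suc k')) ⟩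
  2 ^ (r * k') * primitiveCount 3 (suc k') 0
    ≡⟨ primitiveCount-from-3 r k' 0 ⟨
  primitiveCount (3 + r) (suc k') 0
    ∎

summand-suc : ∀ r k' i → summand (3 + r) (suc k') (suc i) ≡ 2 ^ suc k' * summand (1 + r) (suc k') i
summand-suc r k' i = begin
  2 ^ (k * suc i) * 2 ^ ((3 + r ∸ 2 * suc i ∸ 3) * k') * primitiveCount 3 k (2 ^ (3 + r ∸ 2 * suc i))
    ≡⟨ cong (λ d → 2 ^ (k * suc i) * 2 ^ ((d ∸ 3) * k') * primitiveCount 3 k (2 ^ d)) (3+r∸2[1+i] r i) ⟩
  2 ^ (k * suc i) * B * C
    ≡⟨ cong (λ e → 2 ^ e * B * C) (*-suc k i) ⟩
  2 ^ (k + k * i) * B * C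
    ≡⟨ cong (λ x → x * B * C) (^-distribˡ-+-* 2 k (k * i)) ⟩
  2 ^ k * 2 ^ (k * i) * B * C
    ≡⟨ reassoc (2 ^ k) _ _ _ ⟩
  2 ^ k * summand (1 + r) k i
    ∎
  where
  k = suc k'
  B = 2 ^ ((1 + r ∸ 2 * i ∸ 3) * k')
  C = primitiveCount 3 k (2 ^ (1 + r ∸ 2 * i))
  reassoc : ∀ a b c d → a * b * c * d ≡ a * (b * c * d)
  reassoc = solve-∀

closedForm-step : ∀ r k' q → primitiveCount (3 + r) (suc k') 0 + 2 ^ suc k' * closedForm (1 + r) (suc k') q
                             ≡ closedForm (3 + r) (suc k') (suc q)
closedForm-step r k' q = begin
  P + 2 ^ k * (Σ< q (summand (1 + r) k) + 2 ^ (q * k) * P′ (1 + r ∸ 2 * q) + 2 ^ ((1 + r) / 2 * k))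
    ≡⟨ distrib P (2 ^ k) (Σ< q (summand (1 + r) k)) (2 ^ (q * k) * P′ (1 + r ∸ 2 * q)) (2 ^ ((1 + r) / 2 * k)) ⟩
  P + 2 ^ k * Σ< q (summand (1 + r) k) + 2 ^ k * (2 ^ (q * k) * P′ (1 + r ∸ 2 * q)) + 2 ^ k * 2 ^ ((1 + r) / 2 * k)
    ≡⟨ cong₂ _+_ (cong₂ _+_ (cong₂ _+_ (sym (summand-zero r k')) sum-shift) last-prim) last-pow ⟩
  summand (3 + r) k 0 + Σ< q (λ i → summand (3 + r) k (suc i)) + 2 ^ (suc q * k) * P′ (3 + r ∸ 2 * suc q) + 2 ^ ((3 + r) / 2 * k)
    ≡⟨ cong (λ x → x + 2 ^ (suc q * k) * P′ (3 + r ∸ 2 * suc q) + 2 ^ ((3 + r) / 2 * k)) (Σ<-suc q (summand (3 + r) k)) ⟨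
  closedForm (3 + r) k (suc q)
    ∎
  where
  k = suc k'
  P = primitiveCount (3 + r) k 0
  P′ : ℕ → ℕ
  P′ t = primitiveCount t k 0
  distrib : ∀ a b c d e → a + b * (c + d + e) ≡ a + b * c + b * d + b * e
  distrib = solve-∀
  sum-shift : 2 ^ k * Σ< q (summand (1 + r) k) ≡ Σ< q (λ i → summand (3 + r) k (suc i))
  sum-shift = trans (sym (Σ<-distribˡ-* q (2 ^ k) _)) (sym (Σ<-cong′ q (summand-suc r k')))
  last-prim : 2 ^ k * (2 ^ (q * k) * P′ (1 + r ∸ 2 * q)) ≡ 2 ^ (suc q * k) * P′ (3 + r ∸ 2 * suc q)
  last-prim = begin
    2 ^ k * (2 ^ (q * k) * P′ (1 + r ∸ 2 * q))  ≡⟨ *-assoc (2 ^ k) _ _ ⟨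
    2 ^ k * 2 ^ (q * k) * P′ (1 + r ∸ 2 * q)    ≡⟨ cong₂ _*_ (^-distribˡ-+-* 2 k (q * k)) (cong P′ (3+r∸2[1+i] r q)) ⟨
    2 ^ (suc q * k) * P′ (3 + r ∸ 2 * suc q)    ∎
  last-pow : 2 ^ k * 2 ^ ((1 + r) / 2 * k) ≡ 2 ^ ((3 + r) / 2 * k)
  last-pow = trans (sym (^-distribˡ-+-* 2 k _)) (cong (λ d → 2 ^ (d * k)) (sym (m/n≡1+[m∸n]/n {3 + r} {2} (s≤s (s≤s z≤n)))))

zeroCount-closedForm : ∀ s k' → zeroCount (suc s) (suc k') ≡ closedForm (suc s) (suc k') (s / 2)
zeroCount-closedForm zero k' = begin
  zeroCount 1 k
    ≡⟨ zeroCount≡primitive+imprimitive 1 k ⟩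
  primitiveCount 1 k 0 + imprimitiveCount 1 k
    ≡⟨ cong₂ _+_ (sym (+-identityʳ (primitiveCount 1 k 0))) (imprimitiveCount-1 k) ⟩
  closedForm 1 k 0
    ∎
  where
  k = suc k'
zeroCount-closedForm (suc zero) k' = begin
  zeroCount 2 k
    ≡⟨ zeroCount≡primitive+imprimitive 2 k ⟩
  primitiveCount 2 k 0 + imprimitiveCount 2 k
    ≡⟨ cong₂ _+_ (sym (+-identityʳ (primitiveCount 2 k 0))) (trans (imprimitiveCount-2 k) (cong (2 ^_) (sym (+-identityʳ k)))) ⟩
  closedForm 2 k 0
    ∎
  where
  k = suc k'
zeroCount-closedForm (suc (suc r)) k' = begin
  zeroCount (3 + r) k
    ≡⟨ zeroCount≡primitive+imprimitive (3 + r) k ⟩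
  P + imprimitiveCount (3 + r) k
    ≡⟨ cong (_+_ P) (imprimitiveCount-step r k) ⟩
  P + 2 ^ k * zeroCount (1 + r) k
    ≡⟨ cong (λ z → P + 2 ^ k * z) (zeroCount-closedForm r k') ⟩
  P + 2 ^ k * closedForm (1 + r) k (r / 2)
    ≡⟨ closedForm-step r k' (r / 2) ⟩
  closedForm (3 + r) k (suc (r / 2))
    ≡⟨ cong (closedForm (3 + r) k) (m/n≡1+[m∸n]/n {2 + r} {2} (s≤s (s≤s z≤n))) ⟨
  closedForm (3 + r) k ((2 + r) / 2)
    ∎
  where
  k = suc k'
  P = primitiveCount (3 + r) k 0

-- Counting by enumeration

squareSum : ∀ {n k} → Vec (Fin n) k → ℕ
squareSum []       = 0
squareSum (x ∷ v) = toℕ x * toℕ x + squareSum v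

hasOdd : ∀ {n k} → Vec (Fin n) k → Bool
hasOdd v = does (VAny.any? (λ x → toℕ x % 2 ≟ 1) v)

sumSq≡+squareSum : ∀ {n k} (v : Vec (Fin n) k) → sumSq v ≡ + squareSum v
sumSq≡+squareSum []      = refl
sumSq≡+squareSum (x ∷ v) = cong (λ z → + (toℕ x * toℕ x) ℤ.+ z) (sumSq≡+squareSum v)

%≡%⇔∣∸ : ∀ n .{{_ : NonZero n}} {a b} → a ≤ b → a % n ≡ b % n ⇔ n ∣ b ∸ a
%≡%⇔∣∸ n {a} {b} a≤b = mk⇔ to from
  where
  to : a % n ≡ b % n → n ∣ b ∸ a
  to a≡b = divides (b / n ∸ a / n) (begin
    b ∸ a                                         ≡⟨ cong₂ _∸_ (m≡m%n+[m/n]*n b n) (m≡m%n+[m/n]*n a n) ⟩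
    (b % n + b / n * n) ∸ (a % n + a / n * n)     ≡⟨ cong (λ r → (b % n + b / n * n) ∸ (r + a / n * n)) a≡b ⟩
    (b % n + b / n * n) ∸ (b % n + a / n * n)     ≡⟨ [m+n]∸[m+o]≡n∸o (b % n) _ _ ⟩
    b / n * n ∸ a / n * n                         ≡⟨ *-distribʳ-∸ n (b / n) (a / n) ⟨
    (b / n ∸ a / n) * n                           ∎)
  from : n ∣ b ∸ a → a % n ≡ b % n
  from n∣b∸a = sym (trans (cong (_% n) (sym (m+[n∸m]≡n a≤b))) (%-remove-+ʳ a n∣b∸a))

∣⊖∣-divisible⇔%≡% : ∀ n .{{_ : NonZero n}} a b → n ∣ ∣ a ⊖ b ∣ ⇔ a % n ≡ b % n
∣⊖∣-divisible⇔%≡% n a b with ≤-total a b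
... | inj₁ a≤b rewrite ℤP.∣⊖∣-≤ a≤b = ⇔.sym (%≡%⇔∣∸ n a≤b)
... | inj₂ b≤a rewrite ℤP.∣m⊖n∣≡∣n⊖m∣ a b | ℤP.∣⊖∣-≤ b≤a = ⇔.trans (⇔.sym (%≡%⇔∣∸ n b≤a)) (mk⇔ sym sym)

∣?-eqMod : ∀ n .{{_ : NonZero n}} a b → does (n ∣? ∣ + a ℤ.- + b ∣) ≡ eqMod n a b
∣?-eqMod n a b = does-⇔ (subst (λ d → n ∣ ∣ d ∣ ⇔ a % n ≡ b % n) (sym (ℤP.[+m]-[+n]≡m⊖n a b)) (∣⊖∣-divisible⇔%≡% n a b))
                       (n ∣? ∣ + a ℤ.- + b ∣) (a % n ≟ b % n)

module _ {a p} {A : Set a} {P : Pred A p} (P? : Decidable P) where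

  length-filter-[x] : ∀ x → length (filter P? [ x ]) ≡ 𝟙 (does (P? x))
  length-filter-[x] x with does (P? x)
  ... | true  = refl
  ... | false = refl

  length-filter-concatMap : ∀ {b} {B : Set b} (g : B → List A) xs →
    length (filter P? (concatMap g xs)) ≡ sum (map (λ x → length (filter P? (g x))) xs)
  length-filter-concatMap g []       = refl
  length-filter-concatMap g (x ∷ xs) = begin
    length (filter P? (g x ++ concatMap g xs))                    ≡⟨ cong length (LP.filter-++ P? (g x) _) ⟩
    length (filter P? (g x) ++ filter P? (concatMap g xs))        ≡⟨ LP.length-++ (filter P? (g x)) ⟩
    length (filter P? (g x)) + length (filter P? (concatMap g xs)) ≡⟨ cong (_+_ _) (length-filter-concatMap g xs) ⟩
    length (filter P? (g x)) + sum (map (λ x → length (filter P? (g x))) xs) ∎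

length-filter-map-∷ : ∀ {a p} {A : Set a} {n} {P : Pred (Vec A (suc n)) p} (P? : Decidable P) x vs →
  length (filter P? (map (x ∷_) vs)) ≡ length (filter (λ v → P? (x ∷ v)) vs)
length-filter-map-∷ P? x []       = refl
length-filter-map-∷ P? x (v ∷ vs) with does (P? (x ∷ v))
... | true  = cong suc (length-filter-map-∷ P? x vs)
... | false = length-filter-map-∷ P? x vs

sum-tabulate : ∀ n (h : Fin n → ℕ) (G : ℕ → ℕ) → (∀ i → h i ≡ G (toℕ i)) → sum (tabulate h) ≡ Σ< n G
sum-tabulate zero    h G h≡G = refl
sum-tabulate (suc n) h G h≡G = begin
  h Fin.zero + sum (tabulate (h ∘ Fin.suc))  ≡⟨ cong₂ _+_ (h≡G Fin.zero) (sum-tabulate n (h ∘ Fin.suc) (G ∘ suc) (h≡G ∘ Fin.suc)) ⟩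
  G 0 + Σ< n (G ∘ suc)                       ≡⟨ Σ<-suc n G ⟨
  Σ< (suc n) G                               ∎

length-filter-allVecs : ∀ n k {p} {P : Pred (Vec (Fin n) k) p} (P? : Decidable P) (f : ℕ → Bool → ℕ) →
  (∀ v → 𝟙 (does (P? v)) ≡ f (squareSum v) (hasOdd v)) → length (filter P? (allVecs n k)) ≡ Σsq n k f
length-filter-allVecs n zero    P? f P≡f = trans (length-filter-[x] P? []) (P≡f [])
length-filter-allVecs n (suc k) P? f P≡f = begin
  length (filter P? (concatMap (λ x → map (x ∷_) (allVecs n k)) (allFin n)))
    ≡⟨ length-filter-concatMap P? _ (allFin n) ⟩
  sum (map (λ x → length (filter P? (map (x ∷_) (allVecs n k)))) (allFin n))
    ≡⟨ cong sum (LP.map-tabulate {n = n} id (λ x → length (filter P? (map (x ∷_) (allVecs n k))))) ⟩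
  sum (tabulate (λ x → length (filter P? (map (x ∷_) (allVecs n k)))))
    ≡⟨ sum-tabulate n _ _ (λ x → trans (length-filter-map-∷ P? x (allVecs n k))
                                       (length-filter-allVecs n k (λ v → P? (x ∷ v)) _ (λ v → P≡f (x ∷ v)))) ⟩
  Σsq n (suc k) f
    ∎

∣?-sumSq : ∀ t {k} (v : Vec (Fin (2 ^ t)) k) μ →
  does (2 ^ t ∣? ∣ sumSq v ℤ.- + μ ∣) ≡ eqMod (2 ^ t) {{2^-nonZero t}} (squareSum v) μ
∣?-sumSq t v μ = trans (cong (λ z → does (2 ^ t ∣? ∣ z ℤ.- + μ ∣)) (sumSq≡+squareSum v))
                       (∣?-eqMod (2 ^ t) {{2^-nonZero t}} (squareSum v) μ)

ρ≡zeroCount : ∀ t k → ρ k (+ 0) (2 ^ t) ≡ zeroCount t k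
ρ≡zeroCount t k = length-filter-allVecs (2 ^ t) k _ _ (λ v → cong 𝟙 (∣?-sumSq t v 0))

ρ⁽¹⁾≡primitiveCount : ∀ t k μ → ρ⁽¹⁾ k (+ μ) t ≡ primitiveCount t k μ
ρ⁽¹⁾≡primitiveCount t k μ = length-filter-allVecs (2 ^ t) k _ _ (λ v → cong (λ b → 𝟙 (b ∧ hasOdd v)) (∣?-sumSq t v μ))

theorem4 : (s k : ℕ) → 1 ≤ s → 1 ≤ k →
    ρ k (+ 0) (2 ^ s) ≡
      Σ< ((s ∸ 1) / 2)
         (λ i → 2 ^ (k * i) * 2 ^ ((s ∸ 2 * i ∸ 3) * (k ∸ 1)) * ρ⁽¹⁾ k (+ (2 ^ (s ∸ 2 * i))) 3)
      + 2 ^ (((s ∸ 1) / 2) * k) * ρ⁽¹⁾ k (+ 0) (s ∸ 2 * ((s ∸ 1) / 2))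
      + 2 ^ ((s / 2) * k)
theorem4 zero    _        ()
theorem4 (suc s) zero     _  ()
theorem4 (suc s) (suc k') _  _  = begin
  ρ k (+ 0) (2 ^ suc s)         ≡⟨ ρ≡zeroCount (suc s) k ⟩
  zeroCount (suc s) k           ≡⟨ zeroCount-closedForm s k' ⟩
  closedForm (suc s) k (s / 2)  ≡⟨ cong₂ (λ Σ P → Σ + 2 ^ (s / 2 * k) * P + 2 ^ (suc s / 2 * k))
                                         (Σ<-cong′ (s / 2) (λ i → cong (2 ^ (k * i) * 2 ^ ((suc s ∸ 2 * i ∸ 3) * k') *_)
                                                                        (sym (ρ⁽¹⁾≡primitiveCount 3 k _))))
                                         (sym (ρ⁽¹⁾≡primitiveCount (suc s ∸ 2 * (s / 2)) k 0)) ⟩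
  Σ< (s / 2) (λ i → 2 ^ (k * i) * 2 ^ ((suc s ∸ 2 * i ∸ 3) * k') * ρ⁽¹⁾ k (+ (2 ^ (suc s ∸ 2 * i))) 3)
    + 2 ^ (s / 2 * k) * ρ⁽¹⁾ k (+ 0) (suc s ∸ 2 * (s / 2))
    + 2 ^ (suc s / 2 * k)       ∎
  where
  k = suc k'
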